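{- Let $T$ be a finite tree that contains a cherry. If every proper subtree $T'$ of $T$ satisfies $\operatorname{ind}(T')=m(T')$, then $\operatorname{ind}(T)=m(T)$.
   Context: A cherry in a tree $T$ is a maximal subtree $S$ isomorphic to $K_{1,m}$ for some $m>1$ that contains $m$ end vertices (leaves) of $T$. For a graph $G$, a set $A\subseteq V(G)$ is independent (mod 2) if for every finite nonempty $X\subseteq A$ there is $v\in V(G)\setminus X$ with $|N_G(v)\cap X|$ odd; $\operatorname{ind}(G)$ is the maximum cardinality of such a set. A star decomposition of a tree $T$ is a family $\Sigma$ of pairwise edge-disjoint subtrees, each isomorphic to some $K_{1,m}$ with $m\ge1$, covering all edges of $T$; $t(\Sigma)$ is the number of members isomorphic to $K_{1,1}$ and $s(\Sigma)$ the number isomorphic to $K_{1,m}$ with $m>1$; $m(T):=\min_\Sigma(t(\Sigma)+2s(\Sigma))$. -}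

module Defs where

open import Data.Nat using (ℕ; zero; suc; _+_; _≤_; _%_)
open import Data.Bool using (Bool; true; false)
open import Data.Fin using (Fin; zero; suc; inject₁; fromℕ)
open import Data.Fin.Subset using (Subset; _∈_; _∉_; _⊆_; _∩_; ∣_∣; Nonempty)
open import Data.Vec using (tabulate)
open import Data.List using (List; length; lookup; map)
open import Data.Nat.ListAction using (sum)
open import Data.Product using (Σ; ∃; _×_)
open import Data.Sum using (_⊎_)
open import Relation.Binary.PropositionalEquality using (_≡_)
open import Relation.Nullary using (¬_)
open import Function.Definitions using (Injective)

record Graph (n : ℕ) : Set where
  field
    adj     : Fin n → Fin n → Bool
    sym     : ∀ u v → adj u v ≡ adj v u
    irrefl  : ∀ v → adj v v ≡ false
open Graph public

module _ {n : ℕ} (G : Graph n) where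

  nbhd : Fin n → Subset n
  nbhd v = tabulate (adj G v)

  IsLeaf : Fin n → Set
  IsLeaf v = ∣ nbhd v ∣ ≡ 1

  -- Everything below concerns the induced subgraph G[S] on a vertex set S.

  data Walk (S : Subset n) : Fin n → Fin n → Set where
    here : ∀ {u} → u ∈ S → Walk S u u
    step : ∀ {u w v} → u ∈ S → adj G u w ≡ true → Walk S w v → Walk S u v

  Connected : Subset n → Set
  Connected S = ∀ u v → u ∈ S → v ∈ S → Walk S u v

  -- a cycle of length k+3 in G[S]: distinct vertices f 0 , … , f (k+2)
  Cycle : Subset n → Set
  Cycle S = Σ ℕ λ k → Σ (Fin (suc (suc (suc k))) → Fin n) λ f →
              Injective _≡_ _≡_ f
            × (∀ i → f i ∈ S)
            × (∀ (i : Fin (suc (suc k))) → adj G (f (inject₁ i)) (f (suc i)) ≡ true)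
            × (adj G (f (fromℕ (suc (suc k)))) (f zero) ≡ true)

  IsTree : Subset n → Set
  IsTree S = Nonempty S × Connected S × ¬ Cycle S

  IndependentMod2 : Subset n → Subset n → Set
  IndependentMod2 S A = A ⊆ S ×
    (∀ X → Nonempty X → X ⊆ A →
       ∃ λ v → v ∈ S × v ∉ X × ∣ X ∩ nbhd v ∣ % 2 ≡ 1)

  record Star (S : Subset n) : Set where
    field
      center    : Fin n
      leaves    : Subset n
      center∈   : center ∈ S
      leaves⊆   : leaves ⊆ S
      nonempty  : Nonempty leaves
      adjacent  : ∀ l → l ∈ leaves → adj G center l ≡ true

  EdgeIn : ∀ {S} → Star S → Fin n → Fin n → Set
  EdgeIn st u v = (Star.center st ≡ u × v ∈ Star.leaves st)
                ⊎ (Star.center st ≡ v × u ∈ Star.leaves st)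

  IsStarDecomposition : ∀ S → List (Star S) → Set
  IsStarDecomposition S D = ∀ u v → u ∈ S → v ∈ S → adj G u v ≡ true →
    Σ (Fin (length D)) λ i → EdgeIn (lookup D i) u v ×
      (∀ j → EdgeIn (lookup D j) u v → j ≡ i)

  weightOfSize : ℕ → ℕ
  weightOfSize zero = 0
  weightOfSize (suc zero) = 1
  weightOfSize (suc (suc _)) = 2

  cost : ∀ {S} → List (Star S) → ℕ
  cost D = sum (map (λ st → weightOfSize ∣ Star.leaves st ∣) D)

  IndEqM : Subset n → Set
  IndEqM S = ∃ λ k →
      (∃ λ A → IndependentMod2 S A × ∣ A ∣ ≡ k)
    × (∀ A → IndependentMod2 S A → ∣ A ∣ ≤ k)
    × (∃ λ D → IsStarDecomposition S D × cost D ≡ k)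
    × (∀ D → IsStarDecomposition S D → k ≤ cost D)

  HasCherry : Set
  HasCherry = ∃ λ c → ∃ λ L → 2 ≤ ∣ L ∣
    × (∀ l → l ∈ L → adj G c l ≡ true × IsLeaf l)
    × (∀ l → adj G c l ≡ true → IsLeaf l → l ∈ L)

-- First, ind ≤ m in every graph: a star decomposition Σ gives
-- t(Σ) + 2 s(Σ) linear conditions over GF(2) on subsets X (the value of X at each centre
-- and the parity of X on the leaves of each star, merged into one condition for a single
-- edge), and a nonempty X meeting them all meets the neighbourhood of every vertex outside
-- X evenly; so an independent set has at most as many elements as there are conditions.
-- Second, if c is the centre of a cherry with leaves l and l′, every component of
-- T − c − l is a proper subtree, so optimal independent sets and decompositions of the
-- components glue to ones of T − c − l with ind = m. Adding the star at c costs at most 2,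
-- while adding c and l keeps the set independent: l′ is an odd neighbour of any subset
-- containing c, and c one of ⁅ l ⁆. Hence ind(T) ≥ m(T).
module Submission where

open import Defs renaming (sym to adj-sym)

open import Algebra.Bundles using (CommutativeRing)
open import Data.Bool using (Bool; true; false; not; _∧_; _xor_; if_then_else_)
import Data.Bool.Properties as Bool
open import Data.Bool.Properties
  using (¬-not; ∧-identityʳ; ∧-zeroʳ; ∧-distribʳ-xor; xor-identityʳ; xor-same; xor-∧-commutativeRing)
open import Data.Empty using (⊥-elim) renaming (⊥ to ⊥₀)
open import Data.Fin using (Fin; zero; suc; _≟_)
open import Data.Fin.Properties using (any?; 0≢1+n; suc-injective)
open import Data.Fin.Subset
  using (Subset; _∈_; _∉_; _⊆_; _⊂_; _∩_; _∪_; _─_; _-_; ∣_∣; Nonempty; ⁅_⁆; ⊤; ⊥; inside; outside)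
open import Data.Fin.Subset.Properties
  using (_∈?_; nonempty?; Empty-unique; ∈⊤; ∉⊥; ∣⊥∣≡0; ∣p∣≤n; ∣p∣≡n⇒p≡⊤; ∣⁅x⁆∣≡1;
         x∈⁅x⁆; x∈⁅y⁆⇒x≡y; x≢y⇒x∉⁅y⁆; x∉⁅y⁆⇒x≢y; x∈p∩q⁺; x∈p∩q⁻; x∈p∪q⁻; p⊆p∪q; q⊆p∪q;
         p─q⊆p; p─⊥≡p; x∈p∧x∉q⇒x∈p─q; x∈p∧x≢y⇒x∈p-y; p∩q≢∅⇒p─q⊂p; x∈p⇒∣p-x∣<∣p∣;
         p⊆q⇒∣p∣≤∣q∣; p⊂q⇒∣p∣<∣q∣; ⊆-antisym; ∩-zeroʳ)
open import Data.Fin.Subset.Induction using (⊂-wellFounded; Acc; acc)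
open import Data.List using (List; []; _∷_; length)
import Data.List as List
import Data.List.Properties as List
import Data.List.Relation.Unary.All as ListAll
open import Data.List.Relation.Unary.All using ([]; _∷_)
import Data.List.Relation.Unary.All.Properties as ListAll
import Data.List.Relation.Unary.Any as Any
open import Data.List.Relation.Unary.Any.Properties using (lookup-index)
open import Data.List.Membership.Propositional.Properties using (∈-lookup)
open import Data.Nat using (ℕ; zero; suc; _+_; _≤_; _<_; _%_; z≤n; s≤s; _≤?_)
open import Data.Nat.DivMod using (%-distribˡ-+)
import Data.Nat.ListAction as Nat
open import Data.Nat.ListAction.Properties using (sum-++)
open import Data.Nat.Properties
  using (≤-refl; ≤-reflexive; ≤-trans; ≤-antisym; ≤-pred; <⇒≤; ≰⇒>; n≮n; m≤m+n;
         +-comm; +-suc; +-mono-≤; +-monoʳ-≤; module ≤-Reasoning)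
open import Data.Product using (Σ; ∃; _×_; _,_; proj₁; proj₂)
open import Data.Sum using (_⊎_; inj₁; inj₂)
open import Data.Vec using (Vec; []; _∷_; here; there; lookup; zipWith)
import Data.Vec as Vec
open import Data.Vec.Properties using ([]=⇒lookup; lookup⇒[]=; lookup-zipWith; lookup∘tabulate)
open import Data.Vec.Relation.Unary.All using (All; []; _∷_)
import Data.Vec.Relation.Unary.All as All
open import Data.Vec.Relation.Unary.All.Properties using (map⁺; map⁻; ++⁺; ++⁻)
open import Function using (_∘_)
open import Relation.Nullary using (¬_; ¬?; yes; no; _×-dec_; contradiction)
open import Relation.Nullary.Decidable using (decidable-stable)
open import Relation.Binary.PropositionalEquality
  using (_≡_; _≢_; refl; sym; trans; cong; cong₂; subst; module ≡-Reasoning)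

open import Algebra.Properties.Semiring.Sum (CommutativeRing.semiring xor-∧-commutativeRing)
  using (sum; sum-syntax; ∑-distrib-+; ∑-comm; sum-cong-≗; sum-replicate-zero)
open import Algebra.Properties.CommutativeSemigroup
  (CommutativeRing.+-commutativeSemigroup xor-∧-commutativeRing) using (interchange)

private variable
  n : ℕ

-- Parity of subsets

sum-zero : {f : Fin n → Bool} → (∀ i → f i ≡ false) → sum f ≡ false
sum-zero {n} f≡0 = trans (sum-cong-≗ f≡0) (sum-replicate-zero n)

sum-point : (i : Fin n) {f : Fin n → Bool} → (∀ j → j ≢ i → f j ≡ false) → sum f ≡ f i
sum-point zero    {f} others =
  trans (cong (f zero xor_) (sum-zero (λ j → others (suc j) λ ()))) (xor-identityʳ (f zero))
sum-point (suc i) {f} others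
  rewrite others zero (λ ()) = sum-point i (λ j j≢i → others (suc j) (λ { refl → j≢i refl }))

parity : Subset n → Bool
parity {n} p = ∑[ i < n ] lookup p i

card%2 : (p : Subset n) → ∣ p ∣ % 2 ≡ (if parity p then 1 else 0)
card%2 []            = refl
card%2 (outside ∷ p) = card%2 p
card%2 (inside ∷ p)  = begin
  (1 + ∣ p ∣) % 2                          ≡⟨ %-distribˡ-+ 1 ∣ p ∣ 2 ⟩
  (1 + ∣ p ∣ % 2) % 2                      ≡⟨ cong (λ r → (1 + r) % 2) (card%2 p) ⟩
  (1 + (if parity p then 1 else 0)) % 2   ≡⟨ flip (parity p) ⟩
  (if not (parity p) then 1 else 0)       ∎
  where
  open ≡-Reasoning
  flip : ∀ b → (1 + (if b then 1 else 0)) % 2 ≡ (if not b then 1 else 0)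
  flip true  = refl
  flip false = refl

odd⇒parity : (p : Subset n) → ∣ p ∣ % 2 ≡ 1 → parity p ≡ true
odd⇒parity p odd with parity p | card%2 p
... | true  | _  = refl
... | false | ≡0 with () ← trans (sym odd) ≡0

∈⇒lookup : {x : Fin n} {p : Subset n} → x ∈ p → lookup p x ≡ true
∈⇒lookup = []=⇒lookup

lookup⇒∈ : {x : Fin n} {p : Subset n} → lookup p x ≡ true → x ∈ p
lookup⇒∈ {x = x} {p} = lookup⇒[]= x p

∉⇒lookup : {x : Fin n} {p : Subset n} → x ∉ p → lookup p x ≡ false
∉⇒lookup {x = x} {p} x∉p with lookup p x in eq
... | true  = ⊥-elim (x∉p (lookup⇒∈ eq))
... | false = refl

x∈p─q⇒x∉q : (p q : Subset n) {x : Fin n} → x ∈ p ─ q → x ∉ q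
x∈p─q⇒x∉q (_ ∷ p) (outside ∷ q) here        = λ ()
x∈p─q⇒x∉q (_ ∷ p) (_ ∷ q)       (there x∈p─q) (there x∈q) = x∈p─q⇒x∉q p q x∈p─q x∈q

x∈p-y⇒x≢y : {p : Subset n} {x y : Fin n} → x ∈ p - y → x ≢ y
x∈p-y⇒x≢y {p = p} {y = y} x∈p-y = x∉⁅y⁆⇒x≢y (x∈p─q⇒x∉q p ⁅ y ⁆ x∈p-y)

suc∣p-x∣≡∣p∣ : {p : Subset n} {x : Fin n} → x ∈ p → suc ∣ p - x ∣ ≡ ∣ p ∣
suc∣p-x∣≡∣p∣ {p = inside ∷ p} here = cong (suc ∘ ∣_∣) (p─⊥≡p p)
suc∣p-x∣≡∣p∣ {p = inside ∷ p}  (there x∈p) = cong suc (suc∣p-x∣≡∣p∣ x∈p)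
suc∣p-x∣≡∣p∣ {p = outside ∷ p} (there x∈p) = suc∣p-x∣≡∣p∣ x∈p

∣p∣>0⇒nonempty : (p : Subset n) → 0 < ∣ p ∣ → Nonempty p
∣p∣>0⇒nonempty {n} p 0<∣p∣ with nonempty? p
... | yes ne   = ne
... | no empty = ⊥-elim (n≮n 0 (subst (0 <_) ∣p∣≡0 0<∣p∣))
  where
  ∣p∣≡0 : ∣ p ∣ ≡ 0
  ∣p∣≡0 = trans (cong ∣_∣ (Empty-unique empty)) (∣⊥∣≡0 n)

x∈p⇒∣p∣>0 : {p : Subset n} {x : Fin n} → x ∈ p → 0 < ∣ p ∣
x∈p⇒∣p∣>0 here                       = s≤s z≤n
x∈p⇒∣p∣>0 {p = inside ∷ _}  (there _) = s≤s z≤n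
x∈p⇒∣p∣>0 {p = outside ∷ _} (there x∈p) = x∈p⇒∣p∣>0 x∈p

∣p∣≡1⇒unique : {p : Subset n} {x y : Fin n} → ∣ p ∣ ≡ 1 → x ∈ p → y ∈ p → y ≡ x
∣p∣≡1⇒unique {p = p} {x} {y} ∣p∣≡1 x∈p y∈p with y ≟ x
... | yes y≡x = y≡x
... | no  y≢x = ⊥-elim (n≮n 1 (begin-strict
  1              ≡⟨ ∣⁅x⁆∣≡1 y ⟨
  ∣ ⁅ y ⁆ ∣       ≤⟨ p⊆q⇒∣p∣≤∣q∣ ⁅y⁆⊆p-x ⟩
  ∣ p - x ∣       <⟨ x∈p⇒∣p-x∣<∣p∣ x∈p ⟩
  ∣ p ∣           ≡⟨ ∣p∣≡1 ⟩
  1              ∎))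
  where
  open ≤-Reasoning
  ⁅y⁆⊆p-x : ⁅ y ⁆ ⊆ p - x
  ⁅y⁆⊆p-x z∈⁅y⁆ rewrite x∈⁅y⁆⇒x≡y y z∈⁅y⁆ = x∈p∧x≢y⇒x∈p-y y∈p y≢x

two-elements : {p : Subset n} → 2 ≤ ∣ p ∣ → ∃ λ x → ∃ λ y → x ∈ p × y ∈ p × x ≢ y
two-elements {p = p} 2≤∣p∣ =
  let x , x∈p = ∣p∣>0⇒nonempty p (≤-trans (s≤s z≤n) 2≤∣p∣)
      y , y∈p-x = ∣p∣>0⇒nonempty (p - x) (≤-pred (subst (2 ≤_) (sym (suc∣p-x∣≡∣p∣ x∈p)) 2≤∣p∣))
  in x , y , x∈p , p─q⊆p p ⁅ x ⁆ y∈p-x , λ x≡y → x∈p-y⇒x≢y y∈p-x (sym x≡y)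

p≡⁅x⁆ : {p : Subset n} {x : Fin n} → x ∈ p → (∀ {y} → y ∈ p → y ≡ x) → p ≡ ⁅ x ⁆
p≡⁅x⁆ {x = x} x∈p only-x = ⊆-antisym
  (λ y∈p → subst (_∈ ⁅ x ⁆) (sym (only-x y∈p)) (x∈⁅x⁆ x))
  (λ y∈⁅x⁆ → subst (_∈ _) (sym (x∈⁅y⁆⇒x≡y x y∈⁅x⁆)) x∈p)

p≡⁅x⁆⇒odd : {p : Subset n} {x : Fin n} → p ≡ ⁅ x ⁆ → ∣ p ∣ % 2 ≡ 1
p≡⁅x⁆⇒odd {x = x} refl = cong (_% 2) (∣⁅x⁆∣≡1 x)

∣p∪q∣≡∣p∣+∣q∣ : (p q : Subset n) → (∀ {x} → x ∈ p → x ∉ q) → ∣ p ∪ q ∣ ≡ ∣ p ∣ + ∣ q ∣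
∣p∪q∣≡∣p∣+∣q∣ []            []            _ = refl
∣p∪q∣≡∣p∣+∣q∣ (inside ∷ p)  (inside ∷ q)  disjoint = ⊥-elim (disjoint here here)
∣p∪q∣≡∣p∣+∣q∣ (inside ∷ p)  (outside ∷ q) disjoint =
  cong suc (∣p∪q∣≡∣p∣+∣q∣ p q (λ x∈p x∈q → disjoint (there x∈p) (there x∈q)))
∣p∪q∣≡∣p∣+∣q∣ (outside ∷ p) (inside ∷ q)  disjoint =
  trans (cong suc (∣p∪q∣≡∣p∣+∣q∣ p q (λ x∈p x∈q → disjoint (there x∈p) (there x∈q))))
        (sym (+-suc ∣ p ∣ ∣ q ∣))
∣p∪q∣≡∣p∣+∣q∣ (outside ∷ p) (outside ∷ q) disjoint =
  ∣p∪q∣≡∣p∣+∣q∣ p q (λ x∈p x∈q → disjoint (there x∈p) (there x∈q))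

-- Linear functionals over GF(2)

infixl 6 _⊕_
_⊕_ : Subset n → Subset n → Subset n
p ⊕ q = zipWith _xor_ p q

lookup-⊕ : (p q : Subset n) (x : Fin n) → lookup (p ⊕ q) x ≡ lookup p x xor lookup q x
lookup-⊕ p q x = lookup-zipWith _xor_ x p q

x∈p⊕q⁻ : (p q : Subset n) {x : Fin n} → x ∈ p ⊕ q → x ∈ p ⊎ x ∈ q
x∈p⊕q⁻ (inside ∷ p)  (outside ∷ q) here = inj₁ here
x∈p⊕q⁻ (outside ∷ p) (inside ∷ q)  here = inj₂ here
x∈p⊕q⁻ (_ ∷ p) (_ ∷ q) (there x∈p⊕q) with x∈p⊕q⁻ p q x∈p⊕q
... | inj₁ x∈p = inj₁ (there x∈p)
... | inj₂ x∈q = inj₂ (there x∈q)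

x∈p∧x∉q⇒x∈p⊕q : {p q : Subset n} {x : Fin n} → x ∈ p → x ∉ q → x ∈ p ⊕ q
x∈p∧x∉q⇒x∈p⊕q {p = p} {q} {x} x∈p x∉q = lookup⇒∈ (begin
  lookup (p ⊕ q) x           ≡⟨ lookup-⊕ p q x ⟩
  lookup p x xor lookup q x  ≡⟨ cong₂ _xor_ (∈⇒lookup x∈p) (∉⇒lookup x∉q) ⟩
  true                       ∎)
  where open ≡-Reasoning

lookup-∩ : (p q : Subset n) (x : Fin n) → lookup (p ∩ q) x ≡ lookup p x ∧ lookup q x
lookup-∩ p q x = lookup-zipWith _∧_ x p q

parity-⊕ : (p q : Subset n) → parity (p ⊕ q) ≡ parity p xor parity q
parity-⊕ p q = trans (sum-cong-≗ (lookup-⊕ p q)) (∑-distrib-+ (lookup p) (lookup q))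

∩-distribʳ-⊕ : (p q r : Subset n) → (p ⊕ q) ∩ r ≡ (p ∩ r) ⊕ (q ∩ r)
∩-distribʳ-⊕ []      []      []      = refl
∩-distribʳ-⊕ (a ∷ p) (b ∷ q) (c ∷ r) = cong₂ _∷_ (∧-distribʳ-xor c a b) (∩-distribʳ-⊕ p q r)

parity-∩⁅⁆ : (p : Subset n) (x : Fin n) → parity (p ∩ ⁅ x ⁆) ≡ lookup p x
parity-∩⁅⁆ p x = begin
  parity (p ∩ ⁅ x ⁆)               ≡⟨ sum-point x outside-x ⟩
  lookup (p ∩ ⁅ x ⁆) x             ≡⟨ lookup-∩ p ⁅ x ⁆ x ⟩
  lookup p x ∧ lookup ⁅ x ⁆ x       ≡⟨ cong (lookup p x ∧_) (∈⇒lookup (x∈⁅x⁆ x)) ⟩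
  lookup p x ∧ true                ≡⟨ ∧-identityʳ (lookup p x) ⟩
  lookup p x                       ∎
  where
  open ≡-Reasoning
  outside-x : ∀ y → y ≢ x → lookup (p ∩ ⁅ x ⁆) y ≡ false
  outside-x y y≢x = trans (lookup-∩ p ⁅ x ⁆ y)
    (trans (cong (lookup p y ∧_) (∉⇒lookup (x≢y⇒x∉⁅y⁆ y≢x))) (∧-zeroʳ (lookup p y)))

parity-∩⊥ : (p : Subset n) → parity (p ∩ ⊥) ≡ false
parity-∩⊥ {n} p =
  trans (cong parity (∩-zeroʳ p)) (sum-zero {f = lookup (⊥ {n})} λ x → ∉⇒lookup {x = x} {⊥} ∉⊥)

record Linear (f : Subset n → Bool) : Set where
  constructor mkLinear
  field ⊕-homo : ∀ X Y → f (X ⊕ Y) ≡ f X xor f Y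
open Linear

⊥⊕p≡p : (p : Subset n) → ⊥ ⊕ p ≡ p
⊥⊕p≡p []      = refl
⊥⊕p≡p (b ∷ p) = cong (b ∷_) (⊥⊕p≡p p)

linear-⊥ : {f : Subset n → Bool} → Linear f → f ⊥ ≡ false
linear-⊥ {f = f} linear = begin
  f ⊥             ≡⟨ cong f (⊥⊕p≡p ⊥) ⟨
  f (⊥ ⊕ ⊥)       ≡⟨ ⊕-homo linear ⊥ ⊥ ⟩
  f ⊥ xor f ⊥     ≡⟨ xor-same (f ⊥) ⟩
  false           ∎
  where open ≡-Reasoning

linear-expand : {f : Subset n → Bool} → Linear f →
                ∀ X → f X ≡ ∑[ a < n ] (lookup X a ∧ f ⁅ a ⁆)
linear-expand {zero} linear [] = linear-⊥ linear
linear-expand {suc n} {f} linear (b ∷ X) = begin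
  f (b ∷ X)                            ≡⟨ cong f split ⟩
  f ((b ∷ ⊥) ⊕ (false ∷ X))            ≡⟨ ⊕-homo linear (b ∷ ⊥) (false ∷ X) ⟩
  f (b ∷ ⊥) xor f (false ∷ X)          ≡⟨ cong₂ _xor_ (head-term b) (linear-expand linear-tail X) ⟩
  (b ∧ f ⁅ zero ⁆) xor ∑[ a < n ] (lookup X a ∧ f ⁅ suc a ⁆) ∎
  where
  open ≡-Reasoning
  split : b ∷ X ≡ (b ∷ ⊥) ⊕ (false ∷ X)
  split = cong₂ _∷_ (sym (xor-identityʳ b)) (sym (⊥⊕p≡p X))
  head-term : ∀ b → f (b ∷ ⊥) ≡ b ∧ f ⁅ zero ⁆
  head-term true  = refl
  head-term false = linear-⊥ linear
  linear-tail : Linear (λ Y → f (false ∷ Y))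
  linear-tail = mkLinear λ Y Z → ⊕-homo linear (false ∷ Y) (false ∷ Z)

-- For linear g and f ⁅ a ⁆ = 1, correct f a g X is the value of g at X moved into the
-- kernel of f, i.e. at X ⊕ ⁅ a ⁆ if f X = 1 and at X otherwise.
correct : (f : Subset n → Bool) (a : Fin n) → (Subset n → Bool) → Subset n → Bool
correct f a g X = g X xor (f X ∧ g ⁅ a ⁆)

linear-correct : {f g : Subset n → Bool} (a : Fin n) → Linear f → Linear g → Linear (correct f a g)
linear-correct {f = f} {g} a linear-f linear-g = mkLinear λ X Y → let open ≡-Reasoning in begin
  g (X ⊕ Y) xor (f (X ⊕ Y) ∧ c)
    ≡⟨ cong₂ (λ u v → u xor (v ∧ c)) (⊕-homo linear-g X Y) (⊕-homo linear-f X Y) ⟩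
  (g X xor g Y) xor ((f X xor f Y) ∧ c)
    ≡⟨ cong ((g X xor g Y) xor_) (∧-distribʳ-xor c (f X) (f Y)) ⟩
  (g X xor g Y) xor ((f X ∧ c) xor (f Y ∧ c))
    ≡⟨ interchange (g X) (g Y) (f X ∧ c) (f Y ∧ c) ⟩
  (g X xor (f X ∧ c)) xor (g Y xor (f Y ∧ c))
    ∎
  where
  c : Bool
  c = g ⁅ a ⁆

-- Gaussian elimination: if f ⁅ a ⁆ = 1 for some a ∈ A, recurse on A - a with the other
-- functionals precomposed with the projection onto ker f along ⁅ a ⁆; otherwise f
-- vanishes on every subset of A.
common-zero : ∀ {k} (fs : Vec (Subset n → Bool) k) → All Linear fs →
              (A : Subset n) → k < ∣ A ∣ →
              ∃ λ X → Nonempty X × X ⊆ A × All (λ f → f X ≡ false) fs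
common-zero [] [] A 0<∣A∣ = A , ∣p∣>0⇒nonempty A 0<∣A∣ , (λ x∈A → x∈A) , []
common-zero {n} {suc k} (f ∷ fs) (linear-f ∷ linear-fs) A k<∣A∣
  with any? (λ a → a ∈? A ×-dec f ⁅ a ⁆ Bool.≟ true)
... | no f-vanishes =
  let X , X≢∅ , X⊆A , fs-vanish = common-zero fs linear-fs A (<⇒≤ k<∣A∣)
  in X , X≢∅ , X⊆A , f-zero X⊆A ∷ fs-vanish
  where
  f-zero : ∀ {X} → X ⊆ A → f X ≡ false
  f-zero {X} X⊆A = trans (linear-expand linear-f X) (sum-zero term)
    where
    term : ∀ a → lookup X a ∧ f ⁅ a ⁆ ≡ false
    term a with lookup X a in a∈X
    ... | false = refl
    ... | true  = ¬-not (λ fa → f-vanishes (a , X⊆A (lookup⇒∈ a∈X) , fa))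
... | yes (a , a∈A , f⁅a⁆≡1) =
  let X , X≢∅ , X⊆A-a , vanish = common-zero (Vec.map (correct f a) fs)
        (map⁺ (All.map (linear-correct a linear-f) linear-fs)) (A - a) k<∣A-a∣
  in move-into-kernel X X≢∅ X⊆A-a (map⁻ vanish)
  where
  k<∣A-a∣ : k < ∣ A - a ∣
  k<∣A-a∣ = ≤-pred (subst (suc k <_) (sym (suc∣p-x∣≡∣p∣ a∈A)) k<∣A∣)
  move-into-kernel : ∀ X → Nonempty X → X ⊆ A - a → All (λ g → correct f a g X ≡ false) fs →
                     ∃ λ Y → Nonempty Y × Y ⊆ A × All (λ g → g Y ≡ false) (f ∷ fs)
  move-into-kernel X X≢∅ X⊆A-a vanish with f X in fX
  ... | false =
    X , X≢∅ , p─q⊆p A ⁅ a ⁆ ∘ X⊆A-a , fX ∷ All.map (trans (sym (xor-identityʳ _))) vanish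
  ... | true  = X ⊕ ⁅ a ⁆ , Y≢∅ , Y⊆A , fY ∷ All.map gY (All.zip (linear-fs , vanish))
    where
    Y≢∅ : Nonempty (X ⊕ ⁅ a ⁆)
    Y≢∅ = let x , x∈X = X≢∅ in
      x , x∈p∧x∉q⇒x∈p⊕q x∈X (x≢y⇒x∉⁅y⁆ (x∈p-y⇒x≢y (X⊆A-a x∈X)))
    Y⊆A : X ⊕ ⁅ a ⁆ ⊆ A
    Y⊆A y∈Y with x∈p⊕q⁻ X ⁅ a ⁆ y∈Y
    ... | inj₁ y∈X  = p─q⊆p A ⁅ a ⁆ (X⊆A-a y∈X)
    ... | inj₂ y∈⁅a⁆ = subst (_∈ A) (sym (x∈⁅y⁆⇒x≡y a y∈⁅a⁆)) a∈A
    fY : f (X ⊕ ⁅ a ⁆) ≡ false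
    fY = trans (⊕-homo linear-f X ⁅ a ⁆) (cong₂ _xor_ fX f⁅a⁆≡1)
    gY : ∀ {g} → Linear g × g X xor g ⁅ a ⁆ ≡ false → g (X ⊕ ⁅ a ⁆) ≡ false
    gY (linear-g , gX) = trans (⊕-homo linear-g X ⁅ a ⁆) gX

-- The inequality ind ≤ m

module _ (G : Graph n) {S : Subset n} where

  open Star

  center∉leaves : (st : Star G S) → center st ∉ leaves st
  center∉leaves st c∈L with () ← trans (sym (irrefl G (center st))) (adjacent st _ c∈L)

  ∣leaves∣≢0 : (st : Star G S) → ∣ leaves st ∣ ≢ 0
  ∣leaves∣≢0 st ∣L∣≡0 = let _ , l∈L = nonempty st in n≮n 0 (subst (0 <_) ∣L∣≡0 (x∈p⇒∣p∣>0 l∈L))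

  EdgeIn⇒adj : (st : Star G S) {u w : Fin n} → EdgeIn G st u w → adj G u w ≡ true
  EdgeIn⇒adj st (inj₁ (refl , w∈L)) = adjacent st _ w∈L
  EdgeIn⇒adj st (inj₂ (refl , u∈L)) = trans (adj-sym G _ _) (adjacent st _ u∈L)

  starNbhd : Star G S → Fin n → Subset n
  starNbhd st v with center st ≟ v | lookup (leaves st) v
  ... | yes _ | _     = leaves st
  ... | no _  | true  = ⁅ center st ⁆
  ... | no _  | false = ⊥

  EdgeIn⇒∈starNbhd : (st : Star G S) {v w : Fin n} → EdgeIn G st v w → w ∈ starNbhd st v
  EdgeIn⇒∈starNbhd st {v} (inj₁ (c≡v , w∈L)) with center st ≟ v | lookup (leaves st) v
  ... | yes _   | _ = w∈L
  ... | no  c≢v | _ = ⊥-elim (c≢v c≡v)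
  EdgeIn⇒∈starNbhd st {v} (inj₂ (refl , v∈L)) with center st ≟ v | lookup (leaves st) v in v∈L?
  ... | yes refl | _     = ⊥-elim (center∉leaves st v∈L)
  ... | no _     | true  = x∈⁅x⁆ (center st)
  ... | no _     | false with () ← trans (sym v∈L?) (∈⇒lookup v∈L)

  ∈starNbhd⇒EdgeIn : (st : Star G S) {v w : Fin n} → w ∈ starNbhd st v → EdgeIn G st v w
  ∈starNbhd⇒EdgeIn st {v} w∈N with center st ≟ v | lookup (leaves st) v in v∈L?
  ... | yes c≡v | _     = inj₁ (c≡v , w∈N)
  ... | no _    | true  = inj₂ (sym (x∈⁅y⁆⇒x≡y _ w∈N) , lookup⇒∈ v∈L?)
  ... | no _    | false = ⊥-elim (∉⊥ w∈N)

  adj≡∑starNbhd : (D : List (Star G S)) → IsStarDecomposition G S D →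
                  {v w : Fin n} → v ∈ S → w ∈ S →
                  adj G v w ≡ ∑[ i < length D ] lookup (starNbhd (List.lookup D i) v) w
  adj≡∑starNbhd D decomposition {v} {w} v∈S w∈S with adj G v w in vw
  ... | true  = let i , edge , unique = decomposition v w v∈S w∈S vw in
    sym (trans (sum-point i (λ j j≢i → ¬-not (j≢i ∘ unique j ∘ ∈starNbhd⇒EdgeIn _ ∘ lookup⇒∈)))
               (∈⇒lookup (EdgeIn⇒∈starNbhd _ edge)))
  ... | false = sym (sum-zero λ i → ¬-not λ w∈N →
    let st = List.lookup D i in
    contradiction (trans (sym vw) (EdgeIn⇒adj st (∈starNbhd⇒EdgeIn st (lookup⇒∈ w∈N)))) λ ())

  centreValue leafParity : Star G S → Subset n → Bool
  centreValue st X = lookup X (center st)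
  leafParity  st X = parity (X ∩ leaves st)

  -- Linear conditions on X under which each star neighbourhood of a vertex v ∉ X meets X
  -- evenly. For a single edge one condition suffices: its endpoint v is outside X, so
  -- equality of the values at the two endpoints forces both to vanish.
  functionalsOfSize : Star G S → (k : ℕ) → Vec (Subset n → Bool) (weightOfSize G k)
  functionalsOfSize st zero          = []
  functionalsOfSize st (suc zero)    = (λ X → centreValue st X xor leafParity st X) ∷ []
  functionalsOfSize st (suc (suc _)) = centreValue st ∷ leafParity st ∷ []

  functionals : (st : Star G S) → Vec (Subset n → Bool) (weightOfSize G ∣ leaves st ∣)
  functionals st = functionalsOfSize st ∣ leaves st ∣

  linear-centreValue : (st : Star G S) → Linear (centreValue st)
  linear-centreValue st = mkLinear λ X Y → lookup-⊕ X Y (center st)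

  linear-leafParity : (st : Star G S) → Linear (leafParity st)
  linear-leafParity st = mkLinear λ X Y →
    trans (cong parity (∩-distribʳ-⊕ X Y (leaves st))) (parity-⊕ (X ∩ leaves st) (Y ∩ leaves st))

  linear-functionalsOfSize : (st : Star G S) (k : ℕ) → All Linear (functionalsOfSize st k)
  linear-functionalsOfSize st zero          = []
  linear-functionalsOfSize st (suc zero)    = mkLinear (λ X Y → trans
    (cong₂ _xor_ (⊕-homo (linear-centreValue st) X Y) (⊕-homo (linear-leafParity st) X Y))
    (interchange (centreValue st X) (centreValue st Y) (leafParity st X) (leafParity st Y))) ∷ []
  linear-functionalsOfSize st (suc (suc _)) = linear-centreValue st ∷ linear-leafParity st ∷ []

  module _ (st : Star G S) {X : Subset n} where

    leafParity-vanishes : ∀ k → ∣ leaves st ∣ ≡ k →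
                          All (λ f → f X ≡ false) (functionalsOfSize st k) →
                          center st ∉ X → leafParity st X ≡ false
    leafParity-vanishes (suc zero)    _ (f≡0 ∷ []) c∉X =
      subst (λ b → b xor leafParity st X ≡ false) (∉⇒lookup c∉X) f≡0
    leafParity-vanishes (suc (suc _)) _ (_ ∷ f≡0 ∷ []) _ = f≡0
    leafParity-vanishes zero ∣L∣≡0 _ _ = ⊥-elim (∣leaves∣≢0 st ∣L∣≡0)

    centreValue-vanishes : ∀ k → ∣ leaves st ∣ ≡ k →
                           All (λ f → f X ≡ false) (functionalsOfSize st k) →
                           {v : Fin n} → v ∈ leaves st → v ∉ X → centreValue st X ≡ false
    centreValue-vanishes (suc zero)    ∣L∣≡1 (f≡0 ∷ []) {v} v∈L v∉X =
      trans (sym (xor-identityʳ _)) (subst (λ b → centreValue st X xor b ≡ false) leafParity≡0 f≡0)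
      where
      leafParity≡0 : leafParity st X ≡ false
      leafParity≡0 = begin
        parity (X ∩ leaves st)  ≡⟨ cong (λ L → parity (X ∩ L)) L≡⁅v⁆ ⟩
        parity (X ∩ ⁅ v ⁆)       ≡⟨ parity-∩⁅⁆ X v ⟩
        lookup X v              ≡⟨ ∉⇒lookup v∉X ⟩
        false                   ∎
        where
        open ≡-Reasoning
        L≡⁅v⁆ : leaves st ≡ ⁅ v ⁆
        L≡⁅v⁆ = p≡⁅x⁆ v∈L (∣p∣≡1⇒unique ∣L∣≡1 v∈L)
    centreValue-vanishes (suc (suc _)) _ (f≡0 ∷ _) _ _ = f≡0
    centreValue-vanishes zero ∣L∣≡0 _ _ _ = ⊥-elim (∣leaves∣≢0 st ∣L∣≡0)

    starNbhd-parity-vanishes : All (λ f → f X ≡ false) (functionals st) →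
                               {v : Fin n} → v ∉ X → parity (X ∩ starNbhd st v) ≡ false
    starNbhd-parity-vanishes vanish {v} v∉X with center st ≟ v | lookup (leaves st) v in v∈L?
    ... | yes refl | _     = leafParity-vanishes _ refl vanish v∉X
    ... | no _     | true  = trans (parity-∩⁅⁆ X (center st))
                                   (centreValue-vanishes _ refl vanish (lookup⇒∈ v∈L?) v∉X)
    ... | no _     | false = parity-∩⊥ X

  allFunctionals : (D : List (Star G S)) → Vec (Subset n → Bool) (cost G D)
  allFunctionals []       = []
  allFunctionals (st ∷ D) = functionals st Vec.++ allFunctionals D

  linear-allFunctionals : (D : List (Star G S)) → All Linear (allFunctionals D)
  linear-allFunctionals []       = []
  linear-allFunctionals (st ∷ D) = ++⁺ (linear-functionalsOfSize st _) (linear-allFunctionals D)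

  allFunctionals-vanish⁻ : (D : List (Star G S)) {X : Subset n} →
                           All (λ f → f X ≡ false) (allFunctionals D) →
                           ∀ i → All (λ f → f X ≡ false) (functionals (List.lookup D i))
  allFunctionals-vanish⁻ (st ∷ D) vanish zero    = proj₁ (++⁻ (functionals st) vanish)
  allFunctionals-vanish⁻ (st ∷ D) vanish (suc i) =
    allFunctionals-vanish⁻ D (proj₂ (++⁻ (functionals st) vanish)) i

  parity-∩nbhd : (D : List (Star G S)) → IsStarDecomposition G S D →
                 {X : Subset n} {v : Fin n} → X ⊆ S → v ∈ S →
                 parity (X ∩ nbhd G v) ≡ ∑[ i < length D ] parity (X ∩ starNbhd (List.lookup D i) v)
  parity-∩nbhd D decomposition {X} {v} X⊆S v∈S = begin
    ∑[ w < n ] lookup (X ∩ nbhd G v) w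
      ≡⟨ sum-cong-≗ decompose ⟩
    ∑[ w < n ] ∑[ i < length D ] (lookup X w ∧ N i w)
      ≡⟨ ∑-comm {n} {length D} (λ w i → lookup X w ∧ N i w) ⟩
    ∑[ i < length D ] ∑[ w < n ] (lookup X w ∧ N i w)
      ≡⟨ sum-cong-≗ {length D} (λ i → sum-cong-≗ {n} (λ w → sym (lookup-∩ X _ w))) ⟩
    ∑[ i < length D ] parity (X ∩ starNbhd (List.lookup D i) v)
      ∎
    where
    open ≡-Reasoning
    N : Fin (length D) → Fin n → Bool
    N i w = lookup (starNbhd (List.lookup D i) v) w
    decompose : ∀ w → lookup (X ∩ nbhd G v) w ≡ ∑[ i < length D ] (lookup X w ∧ N i w)
    decompose w with lookup X w in w∈X?
    ... | false = trans (lookup-∩ X _ w)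
                        (trans (cong (_∧ _) w∈X?) (sym (sum-zero {f = λ i → false ∧ N i w} (λ _ → refl))))
    ... | true  = begin
      lookup (X ∩ nbhd G v) w     ≡⟨ lookup-∩ X _ w ⟩
      lookup X w ∧ lookup (nbhd G v) w ≡⟨ cong₂ _∧_ w∈X? (lookup∘tabulate (adj G v) w) ⟩
      adj G v w                   ≡⟨ adj≡∑starNbhd D decomposition v∈S (X⊆S (lookup⇒∈ w∈X?)) ⟩
      ∑[ i < length D ] N i w     ∎

  ∣independent∣≤cost : {A : Subset n} (D : List (Star G S)) →
                       IndependentMod2 G S A → IsStarDecomposition G S D → ∣ A ∣ ≤ cost G D
  ∣independent∣≤cost {A} D (A⊆S , odd-neighbour) decomposition with ∣ A ∣ ≤? cost G D
  ... | yes ∣A∣≤cost = ∣A∣≤cost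
  ... | no  ∣A∣≰cost =
    let X , X≢∅ , X⊆A , vanish =
          common-zero (allFunctionals D) (linear-allFunctionals D) A (≰⇒> ∣A∣≰cost)
        v , v∈S , v∉X , odd = odd-neighbour X X≢∅ X⊆A
        even : parity (X ∩ nbhd G v) ≡ false
        even = trans (parity-∩nbhd D decomposition (A⊆S ∘ X⊆A) v∈S)
                     (sum-zero λ i → starNbhd-parity-vanishes _ (allFunctionals-vanish⁻ D vanish i) v∉X)
    in contradiction (trans (sym even) (odd⇒parity (X ∩ nbhd G v) odd)) λ ()

  indEqM-intro : {A : Subset n} (D : List (Star G S)) →
                 IndependentMod2 G S A → IsStarDecomposition G S D → cost G D ≤ ∣ A ∣ → IndEqM G S
  indEqM-intro {A} D independent decomposition cost≤∣A∣ =
    ∣ A ∣ , (A , independent , refl)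
          , (λ A′ independent′ → ≤-trans (∣independent∣≤cost D independent′ decomposition) cost≤∣A∣)
          , (D , decomposition , ≤-antisym cost≤∣A∣ (∣independent∣≤cost D independent decomposition))
          , (λ D′ decomposition′ → ∣independent∣≤cost D′ independent decomposition′)

-- Connected components

module _ (G : Graph n) where

  walk-snoc : {S : Subset n} {u v w : Fin n} →
              Walk G S u v → w ∈ S → adj G v w ≡ true → Walk G S u w
  walk-snoc (here u∈S)         w∈S vw = step u∈S vw (here w∈S)
  walk-snoc (step u∈S uv walk) w∈S vw = step u∈S uv (walk-snoc walk w∈S vw)

  walk-++ : {S : Subset n} {u v w : Fin n} → Walk G S u v → Walk G S v w → Walk G S u w
  walk-++ (here _)           walk′ = walk′
  walk-++ (step u∈S uv walk) walk′ = step u∈S uv (walk-++ walk walk′)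

  walk-reverse : {S : Subset n} {u v : Fin n} → Walk G S u v → Walk G S v u
  walk-reverse (here u∈S)         = here u∈S
  walk-reverse (step u∈S uv walk) = walk-snoc (walk-reverse walk) u∈S (trans (adj-sym G _ _) uv)

  walk-mono : {S T : Subset n} {u v : Fin n} → S ⊆ T → Walk G S u v → Walk G T u v
  walk-mono S⊆T (here u∈S)         = here (S⊆T u∈S)
  walk-mono S⊆T (step u∈S uv walk) = step (S⊆T u∈S) uv (walk-mono S⊆T walk)

  acyclic-mono : {S T : Subset n} → S ⊆ T → ¬ Cycle G T → ¬ Cycle G S
  acyclic-mono S⊆T acyclic (k , f , injective , f∈S , edges , closing) =
    acyclic (k , f , injective , S⊆T ∘ f∈S , edges , closing)

  ClosedIn : Subset n → Subset n → Set
  ClosedIn S C = ∀ {y w} → y ∈ C → w ∈ S → adj G y w ≡ true → w ∈ C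

  record Component (S : Subset n) (u : Fin n) : Set where
    field
      vertices  : Subset n
      ⊆S        : vertices ⊆ S
      root∈     : u ∈ vertices
      connected : Connected G vertices
      closed    : ClosedIn S vertices

  module _ {S : Subset n} {u : Fin n} where

    -- Y grows by one vertex adjacent to it per step; k bounds the number of vertices
    -- still missing from Y.
    explore : (k : ℕ) (Y : Subset n) → n ≤ k + ∣ Y ∣ → Y ⊆ S → u ∈ Y →
              (∀ {w} → w ∈ Y → Walk G Y u w) → Component S u
    explore k Y bound Y⊆S u∈Y reach
      with any? (λ y → any? (λ w → y ∈? Y ×-dec w ∈? S ×-dec ¬? (w ∈? Y) ×-dec adj G y w Bool.≟ true))
    ... | no no-exit = record
      { vertices  = Y
      ; ⊆S        = Y⊆S
      ; root∈     = u∈Y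
      ; connected = λ a b a∈Y b∈Y → walk-++ (walk-reverse (reach a∈Y)) (reach b∈Y)
      ; closed    = λ {y} {w} y∈Y w∈S yw →
                      decidable-stable (w ∈? Y) λ w∉Y → no-exit (y , w , y∈Y , w∈S , w∉Y , yw)
      }
    ... | yes (y , w , y∈Y , w∈S , w∉Y , yw) with k
    ...   | zero  = ⊥-elim (w∉Y (subst (w ∈_) (sym (∣p∣≡n⇒p≡⊤ (≤-antisym (∣p∣≤n Y) bound))) ∈⊤))
    ...   | suc k = explore k Y′ bound′ Y′⊆S (Y⊆Y′ u∈Y) reach′
      where
      Y′ : Subset n
      Y′ = Y ∪ ⁅ w ⁆
      Y⊆Y′ : Y ⊆ Y′
      Y⊆Y′ = p⊆p∪q ⁅ w ⁆
      w∈Y′ : w ∈ Y′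
      w∈Y′ = q⊆p∪q Y ⁅ w ⁆ (x∈⁅x⁆ w)
      bound′ : n ≤ k + ∣ Y′ ∣
      bound′ = ≤-trans bound (≤-trans (≤-reflexive (sym (+-suc k ∣ Y ∣)))
                 (+-monoʳ-≤ k (p⊂q⇒∣p∣<∣q∣ (Y⊆Y′ , w , w∈Y′ , w∉Y))))
      Y′⊆S : Y′ ⊆ S
      Y′⊆S z∈Y′ with x∈p∪q⁻ Y ⁅ w ⁆ z∈Y′
      ... | inj₁ z∈Y   = Y⊆S z∈Y
      ... | inj₂ z∈⁅w⁆ = subst (_∈ S) (sym (x∈⁅y⁆⇒x≡y w z∈⁅w⁆)) w∈S
      reach′ : ∀ {z} → z ∈ Y′ → Walk G Y′ u z
      reach′ z∈Y′ with x∈p∪q⁻ Y ⁅ w ⁆ z∈Y′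
      ... | inj₁ z∈Y   = walk-mono Y⊆Y′ (reach z∈Y)
      ... | inj₂ z∈⁅w⁆ rewrite x∈⁅y⁆⇒x≡y w z∈⁅w⁆ = walk-snoc (walk-mono Y⊆Y′ (reach y∈Y)) w∈Y′ yw

    component : u ∈ S → Component S u
    component u∈S = explore n ⁅ u ⁆ (m≤m+n n _) ⁅u⁆⊆S (x∈⁅x⁆ u) reach
      where
      ⁅u⁆⊆S : ⁅ u ⁆ ⊆ S
      ⁅u⁆⊆S w∈⁅u⁆ = subst (_∈ S) (sym (x∈⁅y⁆⇒x≡y u w∈⁅u⁆)) u∈S
      reach : ∀ {w} → w ∈ ⁅ u ⁆ → Walk G ⁅ u ⁆ u w
      reach w∈⁅u⁆ rewrite x∈⁅y⁆⇒x≡y u w∈⁅u⁆ = here (x∈⁅x⁆ u)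

  component-isTree : {S : Subset n} {u : Fin n} → ¬ Cycle G ⊤ →
                     (C : Component S u) → IsTree G (Component.vertices C)
  component-isTree acyclic C = (_ , root∈) , connected , acyclic-mono (λ _ → ∈⊤) acyclic
    where open Component C

-- Gluing along a set of vertices closed under adjacency

-- The form in which IsStarDecomposition states that an edge lies in exactly one star.
UniqueIndex : {A : Set} → (A → Set) → List A → Set
UniqueIndex P xs = Σ (Fin (length xs)) λ i → P (List.lookup xs i) × (∀ j → P (List.lookup xs j) → j ≡ i)

None : {A : Set} → (A → Set) → List A → Set
None P = ListAll.All (¬_ ∘ P)

data ExactlyOne {A : Set} (P : A → Set) : List A → Set where
  here  : ∀ {x xs} → P x → None P xs → ExactlyOne P (x ∷ xs)
  there : ∀ {x xs} → ¬ P x → ExactlyOne P xs → ExactlyOne P (x ∷ xs)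

module _ {A : Set} {P : A → Set} where

  exactlyOne-++ˡ : {xs ys : List A} → ExactlyOne P xs → None P ys → ExactlyOne P (xs List.++ ys)
  exactlyOne-++ˡ (here px none) none′ = here px (ListAll.++⁺ none none′)
  exactlyOne-++ˡ (there ¬px one) none′ = there ¬px (exactlyOne-++ˡ one none′)

  exactlyOne-++ʳ : {xs ys : List A} → None P xs → ExactlyOne P ys → ExactlyOne P (xs List.++ ys)
  exactlyOne-++ʳ []            one = one
  exactlyOne-++ʳ (¬px ∷ none) one = there ¬px (exactlyOne-++ʳ none one)

  exactlyOne⇒index : {xs : List A} → ExactlyOne P xs → UniqueIndex P xs
  exactlyOne⇒index (here px none) = zero , px , λ where
    zero    _   → refl
    (suc j) pxj → ⊥-elim (ListAll.lookup none (∈-lookup j) pxj)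
  exactlyOne⇒index (there ¬px one) = let i , pxi , unique = exactlyOne⇒index one in
    suc i , pxi , λ where
      zero    px  → ⊥-elim (¬px px)
      (suc j) pxj → cong suc (unique j pxj)

  index⇒exactlyOne : (xs : List A) → UniqueIndex P xs → ExactlyOne P xs
  index⇒exactlyOne (x ∷ xs) (zero , px , unique) =
    here px (ListAll.tabulate λ y∈xs py →
      0≢1+n (sym (unique (suc (Any.index y∈xs)) (subst P (lookup-index y∈xs) py))))
  index⇒exactlyOne (x ∷ xs) (suc i , pxi , unique) =
    there (λ px → 0≢1+n (unique zero px))
          (index⇒exactlyOne xs (i , pxi , λ j pxj → suc-injective (unique (suc j) pxj)))

exactlyOne-map : {A B : Set} {P : B → Set} (f : A → B) {xs : List A} →
                 ExactlyOne (P ∘ f) xs → ExactlyOne P (List.map f xs)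
exactlyOne-map f (here px none)  = here px (ListAll.map⁺ none)
exactlyOne-map f (there ¬px one) = there ¬px (exactlyOne-map f one)

module _ (G : Graph n) where

  open Star

  ∈nbhd⁻ : {v w : Fin n} → w ∈ nbhd G v → adj G v w ≡ true
  ∈nbhd⁻ {v} {w} w∈N = trans (sym (lookup∘tabulate (adj G v) w)) (∈⇒lookup w∈N)

  ∈nbhd⁺ : {v w : Fin n} → adj G v w ≡ true → w ∈ nbhd G v
  ∈nbhd⁺ {v} {w} vw = lookup⇒∈ (trans (lookup∘tabulate (adj G v) w) vw)

  OddNeighbour : Subset n → Subset n → Set
  OddNeighbour S X = ∃ λ v → v ∈ S × v ∉ X × ∣ X ∩ nbhd G v ∣ % 2 ≡ 1

  oddNeighbour-∩ : {S T B X : Subset n} → IndependentMod2 G T B → T ⊆ S →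
                   Nonempty (X ∩ T) → X ∩ T ⊆ B →
                   (∀ {v w} → v ∈ T → w ∈ X → adj G v w ≡ true → w ∈ T) → OddNeighbour S X
  oddNeighbour-∩ {T = T} {X = X} (_ , independent) T⊆S X∩T≢∅ X∩T⊆B X-nbrs-in-T =
    let v , v∈T , v∉X∩T , odd = independent (X ∩ T) X∩T≢∅ X∩T⊆B
        same : X ∩ nbhd G v ≡ (X ∩ T) ∩ nbhd G v
        same = ⊆-antisym
          (λ w∈ → let w∈X , w∈N = x∈p∩q⁻ X _ w∈ in
             x∈p∩q⁺ (x∈p∩q⁺ (w∈X , X-nbrs-in-T v∈T w∈X (∈nbhd⁻ w∈N)) , w∈N))
          (λ w∈ → let w∈X∩T , w∈N = x∈p∩q⁻ (X ∩ T) _ w∈ in x∈p∩q⁺ (proj₁ (x∈p∩q⁻ X T w∈X∩T) , w∈N))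
    in v , T⊆S v∈T , (λ v∈X → v∉X∩T (x∈p∩q⁺ (v∈X , v∈T)))
         , subst (λ Y → ∣ Y ∣ % 2 ≡ 1) (sym same) odd

  weaken : {S T : Subset n} → S ⊆ T → Star G S → Star G T
  weaken S⊆T st = record
    { center   = center st
    ; leaves   = leaves st
    ; center∈  = S⊆T (center∈ st)
    ; leaves⊆  = S⊆T ∘ leaves⊆ st
    ; nonempty = nonempty st
    ; adjacent = adjacent st
    }

  cost-map-weaken : {S T : Subset n} (S⊆T : S ⊆ T) (D : List (Star G S)) →
                    cost G (List.map (weaken S⊆T) D) ≡ cost G D
  cost-map-weaken S⊆T []       = refl
  cost-map-weaken S⊆T (st ∷ D) = cong (weightOfSize G ∣ leaves st ∣ +_) (cost-map-weaken S⊆T D)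

  cost-++ : {S : Subset n} (D₁ D₂ : List (Star G S)) →
            cost G (D₁ List.++ D₂) ≡ cost G D₁ + cost G D₂
  cost-++ D₁ D₂ = trans (cong Nat.sum (List.map-++ _ D₁ D₂)) (sum-++ (List.map _ D₁) _)

  EdgeIn⇒∈ : {S : Subset n} (st : Star G S) {u w : Fin n} → EdgeIn G st u w → u ∈ S × w ∈ S
  EdgeIn⇒∈ st (inj₁ (refl , w∈L)) = center∈ st , leaves⊆ st w∈L
  EdgeIn⇒∈ st (inj₂ (refl , u∈L)) = leaves⊆ st u∈L , center∈ st

  module _ {S C : Subset n} (C⊆S : C ⊆ S) (closed : ClosedIn G S C) where

    private
      S─C⊆S : S ─ C ⊆ S
      S─C⊆S = p─q⊆p S C
      ∉C : ∀ {x} → x ∈ S ─ C → x ∉ C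
      ∉C = x∈p─q⇒x∉q S C

    disjoint-─ : {A₁ A₂ : Subset n} → A₁ ⊆ C → A₂ ⊆ S ─ C → ∀ {x} → x ∈ A₁ → x ∉ A₂
    disjoint-─ A₁⊆C A₂⊆S─C x∈A₁ x∈A₂ = ∉C (A₂⊆S─C x∈A₂) (A₁⊆C x∈A₁)

    independent-∪ : {A₁ A₂ : Subset n} → IndependentMod2 G C A₁ → IndependentMod2 G (S ─ C) A₂ →
                    IndependentMod2 G S (A₁ ∪ A₂)
    independent-∪ {A₁} {A₂} independent₁@(A₁⊆C , _) (A₂⊆S─C , independent₂) = A⊆S , oddNeighbour
      where
      A⊆S : A₁ ∪ A₂ ⊆ S
      A⊆S x∈A with x∈p∪q⁻ A₁ A₂ x∈A
      ... | inj₁ x∈A₁ = C⊆S (A₁⊆C x∈A₁)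
      ... | inj₂ x∈A₂ = S─C⊆S (A₂⊆S─C x∈A₂)
      oddNeighbour : ∀ X → Nonempty X → X ⊆ A₁ ∪ A₂ → OddNeighbour S X
      oddNeighbour X X≢∅ X⊆A with nonempty? (X ∩ C)
      ... | yes X∩C≢∅ =
        oddNeighbour-∩ independent₁ C⊆S X∩C≢∅ X∩C⊆A₁ λ v∈C w∈X vw → closed v∈C (A⊆S (X⊆A w∈X)) vw
        where
        X∩C⊆A₁ : X ∩ C ⊆ A₁
        X∩C⊆A₁ x∈X∩C with x∈p∩q⁻ X C x∈X∩C
        ... | x∈X , x∈C with x∈p∪q⁻ A₁ A₂ (X⊆A x∈X)
        ...   | inj₁ x∈A₁ = x∈A₁
        ...   | inj₂ x∈A₂ = ⊥-elim (∉C (A₂⊆S─C x∈A₂) x∈C)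
      ... | no  X∩C≡∅ =
        let v , v∈S─C , odd = independent₂ X X≢∅ X⊆A₂ in v , S─C⊆S v∈S─C , odd
        where
        X⊆A₂ : X ⊆ A₂
        X⊆A₂ x∈X with x∈p∪q⁻ A₁ A₂ (X⊆A x∈X)
        ... | inj₁ x∈A₁ = ⊥-elim (X∩C≡∅ (_ , x∈p∩q⁺ (x∈X , A₁⊆C x∈A₁)))
        ... | inj₂ x∈A₂ = x∈A₂

    decomposition-++ : (D₁ : List (Star G C)) (D₂ : List (Star G (S ─ C))) →
                       IsStarDecomposition G C D₁ → IsStarDecomposition G (S ─ C) D₂ →
                       IsStarDecomposition G S
                         (List.map (weaken C⊆S) D₁ List.++ List.map (weaken S─C⊆S) D₂)
    decomposition-++ D₁ D₂ decomposition₁ decomposition₂ u w u∈S w∈S uw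
      = exactlyOne⇒index covered-once
      where
      covered-once : ExactlyOne (λ st → EdgeIn G st u w)
                       (List.map (weaken C⊆S) D₁ List.++ List.map (weaken S─C⊆S) D₂)
      covered-once with u ∈? C
      ... | yes u∈C = exactlyOne-++ˡ
        (exactlyOne-map (weaken C⊆S) (index⇒exactlyOne D₁ (decomposition₁ u w u∈C (closed u∈C w∈S uw) uw)))
        (ListAll.map⁺ (ListAll.universal (λ st edge → ∉C (proj₁ (EdgeIn⇒∈ st edge)) u∈C) D₂))
      ... | no  u∉C = exactlyOne-++ʳ
        (ListAll.map⁺ (ListAll.universal (λ st edge → u∉C (proj₁ (EdgeIn⇒∈ st edge))) D₁))
        (exactlyOne-map (weaken S─C⊆S) (index⇒exactlyOne D₂ (decomposition₂ u w u∈S─C w∈S─C uw)))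
        where
        u∈S─C : u ∈ S ─ C
        u∈S─C = x∈p∧x∉q⇒x∈p─q u∈S u∉C
        w∈S─C : w ∈ S ─ C
        w∈S─C = x∈p∧x∉q⇒x∈p─q w∈S λ w∈C → u∉C (closed w∈C u∈S (trans (adj-sym G w u) uw))

  -- An independent set and a star decomposition witnessing ind ≥ m, hence ind = m.
  record Balanced (S : Subset n) : Set where
    constructor balanced
    field
      {independentSet}   : Subset n
      decomposition      : List (Star G S)
      isIndependent      : IndependentMod2 G S independentSet
      isDecomposition    : IsStarDecomposition G S decomposition
      cost≤∣independent∣ : cost G decomposition ≤ ∣ independentSet ∣

  balanced⇒indEqM : {S : Subset n} → Balanced S → IndEqM G S
  balanced⇒indEqM (balanced D independent decomposition cost≤) =
    indEqM-intro G D independent decomposition cost≤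

  indEqM⇒balanced : {S : Subset n} → IndEqM G S → Balanced S
  indEqM⇒balanced (k , (A , independent , ∣A∣≡k) , _ , (D , decomposition , cost≡k) , _) =
    balanced D independent decomposition (≤-reflexive (trans cost≡k (sym ∣A∣≡k)))

  balanced-empty : {S : Subset n} → ¬ Nonempty S → Balanced S
  balanced-empty S≡∅ = balanced {independentSet = ⊥} []
    ((λ x∈⊥ → ⊥-elim (∉⊥ x∈⊥)) , λ X (_ , x∈X) X⊆⊥ → ⊥-elim (∉⊥ (X⊆⊥ x∈X)))
    (λ u _ u∈S _ _ → ⊥-elim (S≡∅ (u , u∈S)))
    z≤n

  balanced-∪ : {S C : Subset n} (C⊆S : C ⊆ S) → ClosedIn G S C →
               Balanced C → Balanced (S ─ C) → Balanced S
  balanced-∪ {S} {C} C⊆S closed (balanced {A₁} D₁ independent₁ decomposition₁ cost₁≤)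
                                (balanced {A₂} D₂ independent₂ decomposition₂ cost₂≤) =
    balanced (List.map (weaken C⊆S) D₁ List.++ List.map (weaken (p─q⊆p S C)) D₂)
      (independent-∪ C⊆S closed independent₁ independent₂)
      (decomposition-++ C⊆S closed D₁ D₂ decomposition₁ decomposition₂)
      (begin
        cost G (List.map (weaken C⊆S) D₁ List.++ List.map (weaken (p─q⊆p S C)) D₂)
          ≡⟨ cost-++ (List.map (weaken C⊆S) D₁) _ ⟩
        cost G (List.map (weaken C⊆S) D₁) + cost G (List.map (weaken (p─q⊆p S C)) D₂)
          ≡⟨ cong₂ _+_ (cost-map-weaken C⊆S D₁) (cost-map-weaken (p─q⊆p S C) D₂) ⟩
        cost G D₁ + cost G D₂
          ≤⟨ +-mono-≤ cost₁≤ cost₂≤ ⟩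
        ∣ A₁ ∣ + ∣ A₂ ∣
          ≡⟨ ∣p∪q∣≡∣p∣+∣q∣ A₁ A₂ (disjoint-─ C⊆S closed (proj₁ independent₁) (proj₁ independent₂)) ⟨
        ∣ A₁ ∪ A₂ ∣ ∎)
    where open ≤-Reasoning

module _ (G : Graph n) (acyclic : ¬ Cycle G ⊤) {c : Fin n}
         (subtrees : ∀ S → S ≢ ⊤ → IsTree G S → IndEqM G S) where

  -- Every component of G[S] is a proper subtree, so the hypothesis applies to each of them.
  balanced-avoiding : (S : Subset n) → c ∉ S → Balanced G S
  balanced-avoiding S = go S (⊂-wellFounded S)
    where
    go : (S : Subset n) → Acc _⊂_ S → c ∉ S → Balanced G S
    go S (acc smaller) c∉S with nonempty? S
    ... | no  S≡∅        = balanced-empty G S≡∅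
    ... | yes (u , u∈S) = balanced-∪ G ⊆S closed
        (indEqM⇒balanced G (subtrees vertices C≢⊤ (component-isTree G acyclic C)))
        (go (S ─ vertices) (smaller (p∩q≢∅⇒p─q⊂p S vertices (u , x∈p∩q⁺ (u∈S , root∈))))
            (c∉S ∘ p─q⊆p S vertices))
      where
      C : Component G S u
      C = component G u∈S
      open Component C
      C≢⊤ : vertices ≢ ⊤
      C≢⊤ C≡⊤ = c∉S (⊆S (subst (c ∈_) (sym C≡⊤) ∈⊤))

-- Extending across a cherry

module _ (G : Graph n) where

  adj⇒≢ : {u w : Fin n} → adj G u w ≡ true → u ≢ w
  adj⇒≢ {u} uw refl with () ← trans (sym (irrefl G u)) uw

  leaf-unique-neighbour : {l c w : Fin n} → IsLeaf G l → adj G l c ≡ true → adj G l w ≡ true → w ≡ c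
  leaf-unique-neighbour leaf lc lw = ∣p∣≡1⇒unique leaf (∈nbhd⁺ G lc) (∈nbhd⁺ G lw)

  -- The odd neighbour of ⁅ x ⁆ is adjacent to x.
  independent⇒neighbour : {T B : Subset n} {x : Fin n} → IndependentMod2 G T B → x ∈ B →
                          ∃ λ v → v ∈ T × adj G x v ≡ true
  independent⇒neighbour {B = B} {x = x} (_ , independent) x∈B =
    let v , v∈T , _ , odd = independent ⁅ x ⁆ (x , x∈⁅x⁆ x) ⁅x⁆⊆B
        y , y∈ = ∣p∣>0⇒nonempty (⁅ x ⁆ ∩ nbhd G v) (odd⇒>0 odd)
        y∈⁅x⁆ , y∈N = x∈p∩q⁻ ⁅ x ⁆ (nbhd G v) y∈
        vx : adj G v x ≡ true
        vx = subst (λ z → adj G v z ≡ true) (x∈⁅y⁆⇒x≡y x y∈⁅x⁆) (∈nbhd⁻ G y∈N)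
    in v , v∈T , trans (adj-sym G x v) vx
    where
    ⁅x⁆⊆B : ⁅ x ⁆ ⊆ B
    ⁅x⁆⊆B y∈⁅x⁆ = subst (_∈ B) (sym (x∈⁅y⁆⇒x≡y x y∈⁅x⁆)) x∈B
    odd⇒>0 : ∀ {m} → m % 2 ≡ 1 → 0 < m
    odd⇒>0 {suc m} _ = s≤s z≤n

  weightOfSize≤2 : ∀ k → weightOfSize G k ≤ 2
  weightOfSize≤2 zero          = z≤n
  weightOfSize≤2 (suc zero)    = s≤s z≤n
  weightOfSize≤2 (suc (suc _)) = ≤-refl

  -- The star of all edges at c; the neighbour l only witnesses that it is nonempty.
  starAt : (c l : Fin n) → adj G c l ≡ true → Star G ⊤
  starAt c l cl = record
    { center   = c
    ; leaves   = nbhd G c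
    ; center∈  = ∈⊤
    ; leaves⊆  = λ _ → ∈⊤
    ; nonempty = l , ∈nbhd⁺ G cl
    ; adjacent = λ _ → ∈nbhd⁻ G
    }

module Cherry (G : Graph n) (acyclic : ¬ Cycle G ⊤)
              (subtrees : ∀ S → S ≢ ⊤ → IsTree G S → IndEqM G S)
              {c l l′ : Fin n} (l≢l′ : l ≢ l′)
              (cl : adj G c l ≡ true) (leaf-l : IsLeaf G l)
              (cl′ : adj G c l′ ≡ true) (leaf-l′ : IsLeaf G l′) where

  R : Subset n
  R = ⊤ - c - l

  ∈R⁺ : ∀ {x} → x ≢ c → x ≢ l → x ∈ R
  ∈R⁺ x≢c x≢l = x∈p∧x≢y⇒x∈p-y (x∈p∧x≢y⇒x∈p-y ∈⊤ x≢c) x≢l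

  ∈R⇒≢c : ∀ {x} → x ∈ R → x ≢ c
  ∈R⇒≢c x∈R = x∈p-y⇒x≢y (p─q⊆p (⊤ - c) ⁅ l ⁆ x∈R)

  ∈R⇒≢l : ∀ {x} → x ∈ R → x ≢ l
  ∈R⇒≢l = x∈p-y⇒x≢y

  l-nbr : ∀ {w} → adj G l w ≡ true → w ≡ c
  l-nbr = leaf-unique-neighbour G leaf-l (trans (adj-sym G l c) cl)

  l′-nbr : ∀ {w} → adj G l′ w ≡ true → w ≡ c
  l′-nbr = leaf-unique-neighbour G leaf-l′ (trans (adj-sym G l′ c) cl′)

  c≢l : c ≢ l
  c≢l = adj⇒≢ G cl

  forest : Balanced G R
  forest = balanced-avoiding G acyclic subtrees R (λ c∈R → ∈R⇒≢c c∈R refl)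

  open Balanced forest renaming (independentSet to Aᵣ; decomposition to Dᵣ)

  A : Subset n
  A = Aᵣ ∪ (⁅ c ⁆ ∪ ⁅ l ⁆)

  D : List (Star G ⊤)
  D = starAt G c l cl ∷ List.map (weaken G (λ _ → ∈⊤)) Dᵣ

  Aᵣ⊆R : Aᵣ ⊆ R
  Aᵣ⊆R = proj₁ isIndependent

  ∈A⁻ : ∀ {x} → x ∈ A → x ∈ Aᵣ ⊎ x ≡ c ⊎ x ≡ l
  ∈A⁻ x∈A with x∈p∪q⁻ Aᵣ _ x∈A
  ... | inj₁ x∈Aᵣ = inj₁ x∈Aᵣ
  ... | inj₂ x∈cl with x∈p∪q⁻ ⁅ c ⁆ ⁅ l ⁆ x∈cl
  ...   | inj₁ x∈⁅c⁆ = inj₂ (inj₁ (x∈⁅y⁆⇒x≡y c x∈⁅c⁆))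
  ...   | inj₂ x∈⁅l⁆ = inj₂ (inj₂ (x∈⁅y⁆⇒x≡y l x∈⁅l⁆))

  l′∉A : l′ ∉ A
  l′∉A l′∈A with ∈A⁻ l′∈A
  ... | inj₁ l′∈Aᵣ        = let v , v∈R , l′v = independent⇒neighbour G isIndependent l′∈Aᵣ in
                             ∈R⇒≢c v∈R (l′-nbr l′v)
  ... | inj₂ (inj₁ l′≡c) = adj⇒≢ G cl′ (sym l′≡c)
  ... | inj₂ (inj₂ l′≡l) = l≢l′ (sym l′≡l)

  ∣A∣ : ∣ A ∣ ≡ ∣ Aᵣ ∣ + 2
  ∣A∣ = begin
    ∣ Aᵣ ∪ (⁅ c ⁆ ∪ ⁅ l ⁆) ∣          ≡⟨ ∣p∪q∣≡∣p∣+∣q∣ Aᵣ _ Aᵣ∌c,l ⟩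
    ∣ Aᵣ ∣ + ∣ ⁅ c ⁆ ∪ ⁅ l ⁆ ∣         ≡⟨ cong (∣ Aᵣ ∣ +_) (∣p∪q∣≡∣p∣+∣q∣ ⁅ c ⁆ ⁅ l ⁆ c∉⁅l⁆) ⟩
    ∣ Aᵣ ∣ + (∣ ⁅ c ⁆ ∣ + ∣ ⁅ l ⁆ ∣)   ≡⟨ cong₂ (λ a b → ∣ Aᵣ ∣ + (a + b)) (∣⁅x⁆∣≡1 c) (∣⁅x⁆∣≡1 l) ⟩
    ∣ Aᵣ ∣ + 2                      ∎
    where
    open ≡-Reasoning
    Aᵣ∌c,l : ∀ {x} → x ∈ Aᵣ → x ∉ ⁅ c ⁆ ∪ ⁅ l ⁆
    Aᵣ∌c,l x∈Aᵣ x∈cl with x∈p∪q⁻ ⁅ c ⁆ ⁅ l ⁆ x∈cl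
    ... | inj₁ x∈⁅c⁆ = ∈R⇒≢c (Aᵣ⊆R x∈Aᵣ) (x∈⁅y⁆⇒x≡y c x∈⁅c⁆)
    ... | inj₂ x∈⁅l⁆ = ∈R⇒≢l (Aᵣ⊆R x∈Aᵣ) (x∈⁅y⁆⇒x≡y l x∈⁅l⁆)
    c∉⁅l⁆ : ∀ {x} → x ∈ ⁅ c ⁆ → x ∉ ⁅ l ⁆
    c∉⁅l⁆ x∈⁅c⁆ x∈⁅l⁆ = c≢l (trans (sym (x∈⁅y⁆⇒x≡y c x∈⁅c⁆)) (x∈⁅y⁆⇒x≡y l x∈⁅l⁆))

  independent : IndependentMod2 G ⊤ A
  independent = (λ _ → ∈⊤) , oddNeighbour
    where
    oddNeighbour : ∀ X → Nonempty X → X ⊆ A → OddNeighbour G ⊤ X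
    oddNeighbour X X≢∅ X⊆A with c ∈? X
    ... | yes c∈X = l′ , ∈⊤ , l′∉A ∘ X⊆A , p≡⁅x⁆⇒odd X∩N≡⁅c⁆
      where
      X∩N≡⁅c⁆ : X ∩ nbhd G l′ ≡ ⁅ c ⁆
      X∩N≡⁅c⁆ = p≡⁅x⁆ (x∈p∩q⁺ (c∈X , ∈nbhd⁺ G (trans (adj-sym G l′ c) cl′)))
                      (λ y∈ → l′-nbr (∈nbhd⁻ G (proj₂ (x∈p∩q⁻ X _ y∈))))
    ... | no c∉X with nonempty? (X ∩ R)
    ...   | yes X∩R≢∅ = oddNeighbour-∩ G isIndependent (λ _ → ∈⊤) X∩R≢∅ X∩R⊆Aᵣ X-nbrs-in-R
      where
      X∩R⊆Aᵣ : X ∩ R ⊆ Aᵣ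
      X∩R⊆Aᵣ x∈X∩R with x∈p∩q⁻ X R x∈X∩R
      ... | x∈X , x∈R with ∈A⁻ (X⊆A x∈X)
      ...   | inj₁ x∈Aᵣ       = x∈Aᵣ
      ...   | inj₂ (inj₁ x≡c) = ⊥-elim (∈R⇒≢c x∈R x≡c)
      ...   | inj₂ (inj₂ x≡l) = ⊥-elim (∈R⇒≢l x∈R x≡l)
      X-nbrs-in-R : ∀ {v w} → v ∈ R → w ∈ X → adj G v w ≡ true → w ∈ R
      X-nbrs-in-R {v} {w} v∈R w∈X vw = ∈R⁺ (λ { refl → c∉X w∈X })
                                           (λ { refl → ∈R⇒≢c v∈R (l-nbr (trans (adj-sym G l v) vw)) })
    ...   | no X∩R≡∅ = c , ∈⊤ , c∉X , p≡⁅x⁆⇒odd X∩N≡⁅l⁆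
      where
      only-l : ∀ {x} → x ∈ X → x ≡ l
      only-l {x} x∈X with ∈A⁻ (X⊆A x∈X)
      ... | inj₁ x∈Aᵣ       = ⊥-elim (X∩R≡∅ (x , x∈p∩q⁺ (x∈X , Aᵣ⊆R x∈Aᵣ)))
      ... | inj₂ (inj₁ refl) = ⊥-elim (c∉X x∈X)
      ... | inj₂ (inj₂ x≡l) = x≡l
      X∩N≡⁅l⁆ : X ∩ nbhd G c ≡ ⁅ l ⁆
      X∩N≡⁅l⁆ = let x , x∈X = X≢∅ in
        p≡⁅x⁆ (x∈p∩q⁺ (subst (_∈ X) (only-l x∈X) x∈X , ∈nbhd⁺ G cl))
              (λ y∈ → only-l (proj₁ (x∈p∩q⁻ X _ y∈)))

  decomposition : IsStarDecomposition G ⊤ D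
  decomposition u w _ _ uw = exactlyOne⇒index covered-once
    where
    star : Star G ⊤
    star = starAt G c l cl
    none-in-forest : u ≡ c ⊎ w ≡ c → None (λ st → EdgeIn G st u w) (List.map (weaken G (λ _ → ∈⊤)) Dᵣ)
    none-in-forest c∈uw =
      ListAll.map⁺ (ListAll.universal (λ st edge → case c∈uw (EdgeIn⇒∈ G st edge)) Dᵣ)
      where
      case : u ≡ c ⊎ w ≡ c → u ∈ R × w ∈ R → ⊥₀
      case (inj₁ u≡c) (u∈R , _) = ∈R⇒≢c u∈R u≡c
      case (inj₂ w≡c) (_ , w∈R) = ∈R⇒≢c w∈R w≡c
    covered-once : ExactlyOne (λ st → EdgeIn G st u w) D
    covered-once with u ≟ c | w ≟ c
    ... | yes refl | _        = here (inj₁ (refl , ∈nbhd⁺ G uw)) (none-in-forest (inj₁ refl))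
    ... | no _     | yes refl =
      here (inj₂ (refl , ∈nbhd⁺ G (trans (adj-sym G w u) uw))) (none-in-forest (inj₂ refl))
    ... | no u≢c   | no w≢c   = there not-at-c (exactlyOne-map (weaken G (λ _ → ∈⊤))
        (index⇒exactlyOne Dᵣ (isDecomposition u w u∈R w∈R uw)))
      where
      not-at-c : ¬ EdgeIn G star u w
      not-at-c (inj₁ (c≡u , _)) = u≢c (sym c≡u)
      not-at-c (inj₂ (c≡w , _)) = w≢c (sym c≡w)
      u∈R : u ∈ R
      u∈R = ∈R⁺ u≢c λ { refl → w≢c (l-nbr uw) }
      w∈R : w ∈ R
      w∈R = ∈R⁺ w≢c λ { refl → u≢c (l-nbr (trans (adj-sym G l u) uw)) }

  cost≤∣A∣ : cost G D ≤ ∣ A ∣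
  cost≤∣A∣ = begin
    weightOfSize G ∣ nbhd G c ∣ + cost G (List.map (weaken G (λ _ → ∈⊤)) Dᵣ)
      ≡⟨ cong (weightOfSize G ∣ nbhd G c ∣ +_) (cost-map-weaken G (λ _ → ∈⊤) Dᵣ) ⟩
    weightOfSize G ∣ nbhd G c ∣ + cost G Dᵣ   ≤⟨ +-mono-≤ (weightOfSize≤2 G _) cost≤∣independent∣ ⟩
    2 + ∣ Aᵣ ∣                                ≡⟨ +-comm 2 ∣ Aᵣ ∣ ⟩
    ∣ Aᵣ ∣ + 2                                ≡⟨ ∣A∣ ⟨
    ∣ A ∣                                    ∎
    where open ≤-Reasoning

  indEqM : IndEqM G ⊤
  indEqM = balanced⇒indEqM G (balanced D independent decomposition cost≤∣A∣)

mainTheorem12 : (n : ℕ) (G : Graph n) → IsTree G ⊤ → HasCherry G →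
    (∀ (S : Subset n) → S ≢ ⊤ → IsTree G S → IndEqM G S) →
    IndEqM G ⊤
mainTheorem12 n G (_ , _ , acyclic) (c , L , 2≤∣L∣ , cherry-leaves , _) subtrees =
  let l , l′ , l∈L , l′∈L , l≢l′ = two-elements 2≤∣L∣
      cl  , leaf-l  = cherry-leaves l  l∈L
      cl′ , leaf-l′ = cherry-leaves l′ l′∈L
  in Cherry.indEqM G acyclic subtrees l≢l′ cl leaf-l cl′ leaf-l′
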